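{- Let $G$ be a finite cyclic group and $H$ a subgroup of $G$. (a) $H$ is a perfect code of $G$ if and only if either $|H|$ or $|G/H|$ is odd. (b) $H$ is a total perfect code of $G$ if and only if $|H|$ is even and $|G/H|$ is odd.
   Context: All groups and graphs are finite; $e$ denotes the identity. For a group $G$ and $S\subseteq G$ with $e\notin S$ and $S^{ -1}=S$, the Cayley graph $\mathrm{Cay}(G,S)$ has vertex set $G$, with $x,y$ adjacent iff $yx^{ -1}\in S$. A subset $C$ of the vertex set of a graph is a perfect code if every vertex is at distance at most one from exactly one vertex of $C$; it is a total perfect code if every vertex has exactly one neighbour in $C$. A subset $C\subseteq G$ is called a perfect code (resp. total perfect code) of $G$ if it is a perfect code (resp. total perfect code) in some Cayley graph $\mathrm{Cay}(G,S)$ of $G$. -}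

module Defs where

open import Data.Nat using (ℕ; zero; suc; _+_; _*_; _/_)
open import Data.Nat.Divisibility using (_∣_)
open import Data.Fin using (Fin)
open import Data.List using (List; map; allFin)
open import Data.Nat.ListAction using (sum)
open import Data.Bool using (Bool; true; false; if_then_else_)
open import Data.Product using (Σ; _×_; _,_)
open import Data.Sum using (_⊎_)
open import Relation.Nullary using (¬_)
open import Relation.Binary.PropositionalEquality using (_≡_)
open import Algebra.Structures using (IsGroup)
open import Function.Bundles using (_↔_; Inverse)

record FiniteGroup : Set₁ where
  field
    Carrier : Set
    _∙_     : Carrier → Carrier → Carrier
    e       : Carrier
    _⁻¹     : Carrier → Carrier
    isGroup : IsGroup _≡_ _∙_ e _⁻¹
    order   : ℕ
    enum    : Fin order ↔ Carrier

module _ (G : FiniteGroup) where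
  open FiniteGroup G

  -- subsets of G (every subset of a finite set with decidable equality is
  -- decidable, so Bool-valued predicates represent all subsets)
  Subset : Set
  Subset = Carrier → Bool

  _∈_ : Carrier → Subset → Set
  x ∈ A = A x ≡ true

  _∉_ : Carrier → Subset → Set
  x ∉ A = A x ≡ false

  card : Subset → ℕ
  card A = sum (map (λ i → if A (Inverse.to enum i) then 1 else 0) (allFin order))

  pow : Carrier → ℕ → Carrier
  pow g zero    = e
  pow g (suc k) = g ∙ pow g k

  IsCyclic : Set
  IsCyclic = Σ Carrier λ g → (x : Carrier) → Σ ℕ λ k → x ≡ pow g k

  record IsSubgroup (H : Subset) : Set where
    field
      has-e   : e ∈ H
      ∙-closed : ∀ {x y} → x ∈ H → y ∈ H → (x ∙ y) ∈ H
      ⁻¹-closed : ∀ {x} → x ∈ H → (x ⁻¹) ∈ H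

  -- |G/H| = |G| / |H| (number of cosets, by Lagrange); |H| ≥ 1 for subgroups
  index : Subset → ℕ
  index H with card H
  ... | zero  = zero
  ... | suc k = order / suc k

  IsConnectionSet : Subset → Set
  IsConnectionSet S = (e ∉ S) × (∀ s → s ∈ S → (s ⁻¹) ∈ S)

  Adj : Subset → Carrier → Carrier → Set
  Adj S x y = (y ∙ (x ⁻¹)) ∈ S

  ExactlyOne : (Carrier → Set) → Set
  ExactlyOne P = Σ Carrier λ c → P c × (∀ c′ → P c′ → c′ ≡ c)

  IsPerfectCodeIn : Subset → Subset → Set
  IsPerfectCodeIn S C = ∀ x → ExactlyOne (λ c → c ∈ C × (c ≡ x ⊎ Adj S x c))

  IsTotalPerfectCodeIn : Subset → Subset → Set
  IsTotalPerfectCodeIn S C = ∀ x → ExactlyOne (λ c → c ∈ C × Adj S x c)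

  IsPerfectCodeOfGroup : Subset → Set
  IsPerfectCodeOfGroup C = Σ Subset λ S → IsConnectionSet S × IsPerfectCodeIn S C

  IsTotalPerfectCodeOfGroup : Subset → Set
  IsTotalPerfectCodeOfGroup C = Σ Subset λ S → IsConnectionSet S × IsTotalPerfectCodeIn S C

Even : ℕ → Set
Even n = 2 ∣ n

Odd : ℕ → Set
Odd n = ¬ (2 ∣ n)

{-# OPTIONS --safe #-}
module Submission where

-- A subgroup H is a (total) perfect code iff some inverse-closed transversal T of the cosets of H
-- contains (avoids) e; for perfect codes T is the connection set together with e. Write G = ⟨g⟩ of
-- order n = m · d with m = |H| and d = |G/H|, so that H = ⟨gᵈ⟩. If the representative t ∈ T of a
-- coset has t² ∈ H, then t⁻¹ ∈ T represents the same coset, so t² = e. When m and d are both even,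
-- this makes the representative of the coset of g^(d/2) an involution, hence a power of g^(n/2) ∈ H,
-- which is absurd; when e ∉ T it makes the representative of H an involution of H other than e,
-- which forces m to be even. Conversely, the elements g^(±i) with 2i < d, together with g^(n/2) for
-- the middle coset when d is even and m odd, form an inverse-closed transversal through e; when m is
-- even, translating it by the involution g^(n/2) ∈ H moves it off e.

open import Algebra.Bundles using (Group; AbelianGroup)
open import Algebra.Structures using (IsGroup)
import Algebra.Properties.AbelianGroup as AbelianGroupProperties
import Algebra.Properties.CommutativeSemigroup as CommutativeSemigroupProperties
import Algebra.Properties.Group as GroupProperties
open import Axiom.UniquenessOfIdentityProofs using (module Decidable⇒UIP)
open import Data.Bool as Bool using (Bool; true; false; if_then_else_)
open import Data.Fin as Fin using (Fin; zero; suc; toℕ; fromℕ<)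
open import Data.Fin.Permutation using (↔⇒≡)
open import Data.Fin.Properties using (+↔⊎; inj⇒≟; pigeonhole; toℕ-fromℕ<; toℕ-injective; toℕ<n)
open import Data.List using (tabulate)
open import Data.List.Properties using (map-tabulate)
open import Data.Nat as ℕ using (ℕ; _+_; _*_; _∸_; _/_; _%_; _≤_; _<_; NonZero; s<s⁻¹; z<s; s<s)
open import Data.Nat.Properties hiding (_≟_)
open import Data.Nat.DivMod
open import Data.Nat.Divisibility
open import Data.Nat.Coprimality using (Coprime; coprime-divisor)
open import Data.Nat.Primality using (prime⇒irreducible; prime[2])
open import Data.Nat.ListAction using (sum)
open import Data.Product using (∃; _×_; _,_; proj₁; proj₂; uncurry)
open import Data.Sum using (_⊎_; inj₁; inj₂; map; map₁)
open import Data.Product.Function.Dependent.Propositional using (Σ-↔)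
open import Data.Sum.Function.Propositional using (_⊎-cong_)
open import Function using (_∘_; id)
open import Function.Bundles using (_↔_; _⇔_; mk↔ₛ′; mk⇔; Equivalence; Inverse; Injection)
open import Function.Construct.Composition using (_⇔-∘_)
open import Function.Construct.Symmetry using (⇔-sym)
open import Function.Properties.Inverse using (↔-refl; ↔-sym; ↔-trans; ↔⇒↣)
open import Level using (0ℓ)
open import Relation.Binary.Definitions using (DecidableEquality; Tri; tri<; tri≈; tri>)
open import Relation.Binary.PropositionalEquality
open import Data.Empty using (⊥; ⊥-elim)
open import Relation.Nullary using (Dec; yes; no; does; contradiction; ¬?; _×-dec_; _⊎-dec_)
open import Relation.Nullary.Decidable using (dec-false; decidable-stable)
open import Relation.Unary using (Decidable)

open import Defs hiding (_∈_; _∉_)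
import Defs

does-true⇔ : ∀ {A : Set} (a? : Dec A) → does a? ≡ true ⇔ A
does-true⇔ (yes a)  = mk⇔ (λ _ → a) (λ _ → refl)
does-true⇔ (no ¬a) = mk⇔ (λ ()) (λ a → contradiction a ¬a)

indicator : Bool → ℕ
indicator b = if b then 1 else 0

≡true↔Fin-indicator : (b : Bool) → (b ≡ true) ↔ Fin (indicator b)
≡true↔Fin-indicator true  =
  mk↔ₛ′ (λ _ → zero) (λ _ → refl) (λ { zero → refl ; (suc ()) }) (λ { refl → refl })
≡true↔Fin-indicator false = mk↔ₛ′ (λ ()) (λ ()) (λ ()) (λ ())

∃-Fin-suc↔⊎ : ∀ {n} (P : Fin (ℕ.suc n) → Set) → ∃ P ↔ (P zero ⊎ ∃ (λ i → P (suc i)))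
∃-Fin-suc↔⊎ P = mk↔ₛ′ to from to∘from from∘to
  where
  to : ∃ P → P zero ⊎ ∃ (λ i → P (suc i))
  to (zero  , p) = inj₁ p
  to (suc i , p) = inj₂ (i , p)
  from : P zero ⊎ ∃ (λ i → P (suc i)) → ∃ P
  from (inj₁ p)       = zero , p
  from (inj₂ (i , p)) = suc i , p
  to∘from : ∀ x → to (from x) ≡ x
  to∘from (inj₁ _) = refl
  to∘from (inj₂ _) = refl
  from∘to : ∀ x → from (to x) ≡ x
  from∘to (zero  , _) = refl
  from∘to (suc _ , _) = refl

count : ∀ {n} → (Fin n → Bool) → ℕ
count P = sum (tabulate (λ i → indicator (P i)))

∃-true↔Fin-count : ∀ n (P : Fin n → Bool) → ∃ (λ i → P i ≡ true) ↔ Fin (count P)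
∃-true↔Fin-count ℕ.zero    P = mk↔ₛ′ (λ { (() , _) }) (λ ()) (λ ()) (λ { (() , _) })
∃-true↔Fin-count (ℕ.suc n) P =
  ↔-trans (∃-Fin-suc↔⊎ (λ i → P i ≡ true))
  (↔-trans (≡true↔Fin-indicator (P zero) ⊎-cong ∃-true↔Fin-count n (λ i → P (suc i)))
           (↔-sym +↔⊎))

least : (P : ℕ → Bool) {n : ℕ} → P n ≡ true → ∃ λ k → P k ≡ true × (∀ {j} → j < k → P j ≡ false)
least P {ℕ.zero} Pn = 0 , Pn , λ ()
least P {ℕ.suc n} Pn with P 0 in P0
... | true  = 0 , P0 , λ ()
... | false with k , Pk , below ← least (P ∘ ℕ.suc) Pn =
  ℕ.suc k , Pk , λ { {ℕ.zero} _ → P0 ; {ℕ.suc j} j<k → below (s<s⁻¹ j<k) }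

double≡*2 : ∀ u → u + u ≡ u * 2
double≡*2 u = trans (cong (u +_) (sym (+-identityʳ u))) (*-comm 2 u)

half<whole : ∀ {u k} .{{_ : NonZero k}} → u + u ≡ k → u < k
half<whole {ℕ.zero}  {ℕ.suc _} ()
half<whole {ℕ.suc u} refl = m<m+n (ℕ.suc u) z<s

even⇒half : ∀ {k} → Even k → ∃ λ u → u + u ≡ k
even⇒half (divides u k≡u*2) = u , trans (double≡*2 u) (sym k≡u*2)

double-even : ∀ u → Even (u + u)
double-even u = divides u (double≡*2 u)

odd⇒≡1+[k/2]*2 : ∀ {k} → Odd k → k ≡ 1 + k / 2 * 2
odd⇒≡1+[k/2]*2 {k} k-odd with k % 2 in k%2≡r | m%n<n k 2
... | 0           | _ = contradiction (m%n≡0⇒n∣m k 2 k%2≡r) k-odd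
... | 1           | _ = trans (m≡m%n+[m/n]*n k 2) (cong (_+ k / 2 * 2) k%2≡r)
... | ℕ.suc (ℕ.suc _) | s<s (s<s ())

odd⇒coprime-2 : ∀ {k} → Odd k → Coprime k 2
odd⇒coprime-2 k-odd (i∣k , i∣2) with prime⇒irreducible prime[2] i∣2
... | inj₁ i≡1 = i≡1
... | inj₂ refl = contradiction i∣k k-odd

module _ (G : FiniteGroup) where
  open FiniteGroup G renaming (_∙_ to infixl 7 _∙_; _⁻¹ to infix 8 _⁻¹)
  open IsGroup isGroup using (assoc; identityˡ; identityʳ; inverseʳ)

  group : Group 0ℓ 0ℓ
  group = record { isGroup = isGroup }

  open GroupProperties group
    using (ε⁻¹≈ε; ⁻¹-involutive; ⁻¹-anti-homo-∙; x∙y⁻¹≈ε⇒x≈y; x≈y⇒x∙y⁻¹≈ε; inverseʳ-unique;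
           identityʳ-unique; //-rightDividesˡ; //-rightDividesʳ; \\-leftDividesʳ)

  infix 4 _∈_ _∉_
  _∈_ : Carrier → Subset G → Set
  _∈_ = Defs._∈_ G

  _∉_ : Carrier → Subset G → Set
  _∉_ = Defs._∉_ G

  infixr 9 _^_
  _^_ : Carrier → ℕ → Carrier
  _^_ = pow G

  _≟_ : DecidableEquality Carrier
  _≟_ = inj⇒≟ (↔⇒↣ (↔-sym enum))

  ⟦_⟧ : {P : Carrier → Set} → Decidable P → Subset G
  ⟦ P? ⟧ x = does (P? x)

  ∈⟦⟧ : {P : Carrier → Set} (P? : Decidable P) {x : Carrier} → x ∈ ⟦ P? ⟧ ⇔ P x
  ∈⟦⟧ P? {x} = does-true⇔ (P? x)

  ∃-≡ : {A : Subset G} {x y : Carrier} {x∈A : x ∈ A} {y∈A : y ∈ A} →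
        x ≡ y → _≡_ {A = ∃ (_∈ A)} (x , x∈A) (y , y∈A)
  ∃-≡ refl = cong (_ ,_) (Decidable⇒UIP.≡-irrelevant Bool._≟_ _ _)

  card↔ : (A : Subset G) → ∃ (_∈ A) ↔ Fin (card G A)
  card↔ A = subst (λ k → ∃ (_∈ A) ↔ Fin k) (sym card≡count)
    (↔-trans (↔-sym (Σ-↔ enum ↔-refl)) (∃-true↔Fin-count order (A ∘ Inverse.to enum)))
    where
    card≡count : card G A ≡ count (A ∘ Inverse.to enum)
    card≡count = cong sum (map-tabulate id (indicator ∘ A ∘ Inverse.to enum))

  index≡ : (A : Subset G) {k : ℕ} .{{_ : NonZero k}} → card G A ≡ k → index G A ≡ order / k
  index≡ A {ℕ.suc k} card≡k rewrite card≡k = refl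

  pow-+ : ∀ x a b → x ^ (a + b) ≡ x ^ a ∙ x ^ b
  pow-+ x ℕ.zero    b = sym (identityˡ _)
  pow-+ x (ℕ.suc a) b = trans (cong (x ∙_) (pow-+ x a b)) (sym (assoc _ _ _))

  pow-∈ : {K : Subset G} → IsSubgroup G K → ∀ {x d} → x ^ d ∈ K → ∀ q → x ^ (q * d) ∈ K
  pow-∈ K-sub x^d∈K ℕ.zero    = IsSubgroup.has-e K-sub
  pow-∈ {K} K-sub {x} {d} x^d∈K (ℕ.suc q) =
    subst (_∈ K) (sym (pow-+ x d (q * d))) (IsSubgroup.∙-closed K-sub x^d∈K (pow-∈ K-sub x^d∈K q))

  ｛e｝ : Subset G
  ｛e｝ = ⟦ _≟ e ⟧

  ∈｛e｝⇔≡e : ∀ {x} → x ∈ ｛e｝ ⇔ x ≡ e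
  ∈｛e｝⇔≡e = ∈⟦⟧ (_≟ e)

  ｛e｝-isSubgroup : IsSubgroup G ｛e｝
  ｛e｝-isSubgroup = record
    { has-e     = from ∈｛e｝⇔≡e refl
    ; ∙-closed  = λ x∈ y∈ → from ∈｛e｝⇔≡e (trans (cong₂ _∙_ (to ∈｛e｝⇔≡e x∈) (to ∈｛e｝⇔≡e y∈)) (identityˡ e))
    ; ⁻¹-closed = λ x∈ → from ∈｛e｝⇔≡e (trans (cong _⁻¹ (to ∈｛e｝⇔≡e x∈)) ε⁻¹≈ε)
    }
    where open Equivalence

  ExactlyOne-cong : {P Q : Carrier → Set} → (∀ c → P c ⇔ Q c) → ExactlyOne G P ⇔ ExactlyOne G Q
  ExactlyOne-cong P⇔Q = mk⇔ (transport P⇔Q) (transport (⇔-sym ∘ P⇔Q))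
    where
    transport : {P Q : Carrier → Set} → (∀ c → P c ⇔ Q c) → ExactlyOne G P → ExactlyOne G Q
    transport P⇔Q (c , Pc , unique) =
      c , Equivalence.to (P⇔Q c) Pc , λ c′ Qc′ → unique c′ (Equivalence.from (P⇔Q c′) Qc′)

  perfectCodeIn⇔totalPerfectCodeIn : {S T C : Subset G} → (∀ y → y ∈ T ⇔ (y ≡ e ⊎ y ∈ S)) →
                                      IsPerfectCodeIn G S C ⇔ IsTotalPerfectCodeIn G T C
  perfectCodeIn⇔totalPerfectCodeIn {S} {T} {C} T≐e∪S =
    mk⇔ (λ pc x → Equivalence.to (ExactlyOne-cong (closed⇔open x)) (pc x))
        (λ tpc x → Equivalence.from (ExactlyOne-cong (closed⇔open x)) (tpc x))
    where
    closed⇔open : ∀ x c → (c ∈ C × (c ≡ x ⊎ Adj G S x c)) ⇔ (c ∈ C × Adj G T x c)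
    closed⇔open x c = mk⇔ closed⇒open open⇒closed
      where
      open Equivalence (T≐e∪S (c ∙ x ⁻¹))
      closed⇒open : c ∈ C × (c ≡ x ⊎ Adj G S x c) → c ∈ C × Adj G T x c
      closed⇒open (c∈C , inj₁ c≡x) = c∈C , from (inj₁ (x≈y⇒x∙y⁻¹≈ε c≡x))
      closed⇒open (c∈C , inj₂ adj) = c∈C , from (inj₂ adj)
      open⇒closed : c ∈ C × Adj G T x c → c ∈ C × (c ≡ x ⊎ Adj G S x c)
      open⇒closed (c∈C , adj) = c∈C , map₁ (x∙y⁻¹≈ε⇒x≈y c x) (to adj)

  module Cosets {K : Subset G} (K-sub : IsSubgroup G K) where
    open IsSubgroup K-sub

    infix 4 _~_
    _~_ : Carrier → Carrier → Set
    x ~ y = x ∙ y ⁻¹ ∈ K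

    ~-refl : ∀ {x} → x ~ x
    ~-refl {x} = subst (_∈ K) (sym (inverseʳ x)) has-e

    ~-sym : ∀ {x y} → x ~ y → y ~ x
    ~-sym {x} {y} x~y = subst (_∈ K) [xy⁻¹]⁻¹≡yx⁻¹ (⁻¹-closed x~y)
      where
      [xy⁻¹]⁻¹≡yx⁻¹ : (x ∙ y ⁻¹) ⁻¹ ≡ y ∙ x ⁻¹
      [xy⁻¹]⁻¹≡yx⁻¹ = trans (⁻¹-anti-homo-∙ x (y ⁻¹)) (cong (_∙ x ⁻¹) (⁻¹-involutive y))

    ~-trans : ∀ {x y z} → x ~ y → y ~ z → x ~ z
    ~-trans {x} {y} {z} x~y y~z =
      subst (_∈ K) (trans (assoc x (y ⁻¹) (y ∙ z ⁻¹)) (cong (x ∙_) (\\-leftDividesʳ y (z ⁻¹))))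
            (∙-closed x~y y~z)

    ∈⇒∙~ : ∀ {h x} → h ∈ K → h ∙ x ~ x
    ∈⇒∙~ {h} {x} h∈K = subst (_∈ K) (sym (//-rightDividesʳ x h)) h∈K

    ~e⇔∈ : ∀ {x} → x ~ e ⇔ x ∈ K
    ~e⇔∈ {x} = mk⇔ (subst (_∈ K) x∙e⁻¹≡x) (subst (_∈ K) (sym x∙e⁻¹≡x))
      where
      x∙e⁻¹≡x : x ∙ e ⁻¹ ≡ x
      x∙e⁻¹≡x = trans (cong (x ∙_) ε⁻¹≈ε) (identityʳ x)

  module Transversals {H : Subset G} (H-sub : IsSubgroup G H) where
    open IsSubgroup H-sub
    open Cosets H-sub

    InverseClosed : Subset G → Set
    InverseClosed T = ∀ t → t ∈ T → t ⁻¹ ∈ T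

    record IsTransversal (T : Subset G) : Set where
      field
        cover  : ∀ x → ∃ λ t → t ∈ T × t ~ x
        unique : ∀ {t t′} → t ∈ T → t′ ∈ T → t ~ t′ → t ≡ t′

    totalPerfectCodeIn⇔transversal : ∀ {T} → IsTotalPerfectCodeIn G T H ⇔ IsTransversal T
    totalPerfectCodeIn⇔transversal {T} = mk⇔ toTransversal fromTransversal
      where
      toTransversal : IsTotalPerfectCodeIn G T H → IsTransversal T
      toTransversal tpc = record { cover = cover ; unique = unique }
        where
        cover : ∀ x → ∃ λ t → t ∈ T × t ~ x
        cover x with c , (c∈H , c∙x⁻¹⁻¹∈T) , _ ← tpc (x ⁻¹) =
          c ∙ x ⁻¹ ⁻¹ , c∙x⁻¹⁻¹∈T , subst (_∈ H) (sym (//-rightDividesˡ (x ⁻¹) c)) c∈H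
        unique : ∀ {t t′} → t ∈ T → t′ ∈ T → t ~ t′ → t ≡ t′
        unique {t} {t′} t∈T t′∈T t~t′ =
          x∙y⁻¹≈ε⇒x≈y t t′ (trans (only (t ∙ t′ ⁻¹) (t~t′ , subst (_∈ T) (sym t∙t′⁻¹∙t′⁻¹⁻¹≡t) t∈T))
                                 (sym (only e (has-e , subst (_∈ T) (sym e∙t′⁻¹⁻¹≡t′) t′∈T))))
          where
          only = proj₂ (proj₂ (tpc (t′ ⁻¹)))
          t∙t′⁻¹∙t′⁻¹⁻¹≡t : (t ∙ t′ ⁻¹) ∙ t′ ⁻¹ ⁻¹ ≡ t
          t∙t′⁻¹∙t′⁻¹⁻¹≡t = trans (cong ((t ∙ t′ ⁻¹) ∙_) (⁻¹-involutive t′)) (//-rightDividesˡ t′ t)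
          e∙t′⁻¹⁻¹≡t′ : e ∙ t′ ⁻¹ ⁻¹ ≡ t′
          e∙t′⁻¹⁻¹≡t′ = trans (identityˡ _) (⁻¹-involutive t′)
      fromTransversal : IsTransversal T → IsTotalPerfectCodeIn G T H
      fromTransversal tr x with t , t∈T , t~x⁻¹ ← IsTransversal.cover tr (x ⁻¹) =
        t ∙ x ⁻¹ ⁻¹ , (t~x⁻¹ , subst (_∈ T) (sym (//-rightDividesˡ (x ⁻¹) t)) t∈T) , only
        where
        only : ∀ c → c ∈ H × c ∙ x ⁻¹ ∈ T → c ≡ t ∙ x ⁻¹ ⁻¹
        only c (c∈H , c∙x⁻¹∈T) = trans (sym (//-rightDividesʳ (x ⁻¹) c)) (cong (_∙ x ⁻¹ ⁻¹) c∙x⁻¹≡t)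
          where
          c∙x⁻¹≡t : c ∙ x ⁻¹ ≡ t
          c∙x⁻¹≡t = IsTransversal.unique tr c∙x⁻¹∈T t∈T (~-trans (∈⇒∙~ c∈H) (~-sym t~x⁻¹))

    totalPerfectCode⇔ : IsTotalPerfectCodeOfGroup G H ⇔ ∃ λ T → e ∉ T × InverseClosed T × IsTransversal T
    totalPerfectCode⇔ = mk⇔
      (λ (T , (e∉T , T-ic) , tpc) → T , e∉T , T-ic , Equivalence.to totalPerfectCodeIn⇔transversal tpc)
      (λ (T , e∉T , T-ic , tr) → T , (e∉T , T-ic) , Equivalence.from totalPerfectCodeIn⇔transversal tr)

    perfectCode⇔ : IsPerfectCodeOfGroup G H ⇔ ∃ λ T → e ∈ T × InverseClosed T × IsTransversal T
    perfectCode⇔ = mk⇔ fromPerfectCode toPerfectCode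
      where
      fromPerfectCode : IsPerfectCodeOfGroup G H → ∃ λ T → e ∈ T × InverseClosed T × IsTransversal T
      fromPerfectCode (S , (_ , S-ic) , pc) = T , from (T≐e∪S e) (inj₁ refl) , T-ic , transversal
        where
        open Equivalence
        e∪S? : Decidable (λ y → y ≡ e ⊎ y ∈ S)
        e∪S? y = y ≟ e ⊎-dec S y Bool.≟ true
        T : Subset G
        T = ⟦ e∪S? ⟧
        T≐e∪S : ∀ y → y ∈ T ⇔ (y ≡ e ⊎ y ∈ S)
        T≐e∪S y = ∈⟦⟧ e∪S?
        T-ic : InverseClosed T
        T-ic t t∈T = from (T≐e∪S (t ⁻¹))
          (map (λ t≡e → trans (cong _⁻¹ t≡e) ε⁻¹≈ε) (S-ic t) (to (T≐e∪S t) t∈T))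
        transversal : IsTransversal T
        transversal = to totalPerfectCodeIn⇔transversal (to (perfectCodeIn⇔totalPerfectCodeIn T≐e∪S) pc)
      toPerfectCode : (∃ λ T → e ∈ T × InverseClosed T × IsTransversal T) → IsPerfectCodeOfGroup G H
      toPerfectCode (T , e∈T , T-ic , tr) = S , (e∉S , S-ic) , pc
        where
        open Equivalence
        T∖e? : Decidable (λ y → y ∈ T × y ≢ e)
        T∖e? y = T y Bool.≟ true ×-dec ¬? (y ≟ e)
        S : Subset G
        S = ⟦ T∖e? ⟧
        S-spec : ∀ {y} → y ∈ S ⇔ (y ∈ T × y ≢ e)
        S-spec = ∈⟦⟧ T∖e?
        e∉S : e ∉ S
        e∉S = dec-false (T∖e? e) (λ (_ , e≢e) → e≢e refl)
        S-ic : InverseClosed S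
        S-ic s s∈S with s∈T , s≢e ← to S-spec s∈S =
          from S-spec (T-ic s s∈T , λ s⁻¹≡e →
            s≢e (trans (sym (⁻¹-involutive s)) (trans (cong _⁻¹ s⁻¹≡e) ε⁻¹≈ε)))
        T≐e∪S : ∀ y → y ∈ T ⇔ (y ≡ e ⊎ y ∈ S)
        T≐e∪S y = mk⇔ split join
          where
          split : y ∈ T → y ≡ e ⊎ y ∈ S
          split y∈T with y ≟ e
          ... | yes y≡e = inj₁ y≡e
          ... | no  y≢e = inj₂ (from S-spec (y∈T , y≢e))
          join : y ≡ e ⊎ y ∈ S → y ∈ T
          join (inj₁ refl) = e∈T
          join (inj₂ y∈S)  = proj₁ (to S-spec y∈S)
        pc : IsPerfectCodeIn G S H
        pc = from (perfectCodeIn⇔totalPerfectCodeIn T≐e∪S) (from totalPerfectCodeIn⇔transversal tr)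

    square∈⇒square≡e : ∀ {T t} → InverseClosed T → IsTransversal T → t ∈ T → t ∙ t ∈ H → t ∙ t ≡ e
    square∈⇒square≡e {T} {t} T-ic tr t∈T t∙t∈H =
      trans (cong (t ∙_) (IsTransversal.unique tr t∈T (T-ic t t∈T) t~t⁻¹)) (inverseʳ t)
      where
      t~t⁻¹ : t ~ t ⁻¹
      t~t⁻¹ = subst (_∈ H) (cong (t ∙_) (sym (⁻¹-involutive t))) t∙t∈H

    record IsSymmetricSection (rep : Carrier → Carrier) : Set where
      field
        rep~     : ∀ x → rep x ~ x
        rep-cong : ∀ {x y} → x ~ y → rep x ≡ rep y
        rep-⁻¹   : ∀ x → rep (x ⁻¹) ≡ rep x ⁻¹

    fixedPoints : (Carrier → Carrier) → Subset G
    fixedPoints rep = ⟦ (λ x → rep x ≟ x) ⟧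

    ∈fixedPoints⇔ : ∀ rep {x} → x ∈ fixedPoints rep ⇔ rep x ≡ x
    ∈fixedPoints⇔ rep = ∈⟦⟧ (λ x → rep x ≟ x)

    module _ {rep : Carrier → Carrier} (section : IsSymmetricSection rep) where
      open IsSymmetricSection section
      open Equivalence

      fixedPoints-inverseClosed : InverseClosed (fixedPoints rep)
      fixedPoints-inverseClosed t t∈ =
        from (∈fixedPoints⇔ rep) (trans (rep-⁻¹ t) (cong _⁻¹ (to (∈fixedPoints⇔ rep) t∈)))

      fixedPoints-transversal : IsTransversal (fixedPoints rep)
      fixedPoints-transversal = record
        { cover  = λ x → rep x , from (∈fixedPoints⇔ rep) (rep-cong (rep~ x)) , rep~ x
        ; unique = λ t∈ t′∈ t~t′ →
            trans (sym (to (∈fixedPoints⇔ rep) t∈)) (trans (rep-cong t~t′) (to (∈fixedPoints⇔ rep) t′∈))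
        }

      symmetricSection⇒transversal∋e : rep e ≡ e → ∃ λ T → e ∈ T × InverseClosed T × IsTransversal T
      symmetricSection⇒transversal∋e rep-e≡e =
        fixedPoints rep , from (∈fixedPoints⇔ rep) rep-e≡e ,
        fixedPoints-inverseClosed , fixedPoints-transversal

      symmetricSection⇒transversal∌e : rep e ≢ e → ∃ λ T → e ∉ T × InverseClosed T × IsTransversal T
      symmetricSection⇒transversal∌e rep-e≢e =
        fixedPoints rep , dec-false (rep e ≟ e) rep-e≢e ,
        fixedPoints-inverseClosed , fixedPoints-transversal

      translate : (∀ x y → x ∙ y ≡ y ∙ x) → ∀ {z} → z ∈ H → z ∙ z ≡ e →
                  IsSymmetricSection (λ x → rep x ∙ z)
      translate comm {z} z∈H z∙z≡e = record
        { rep~     = λ x → ~-trans (subst (_~ rep x) (comm z (rep x)) (∈⇒∙~ z∈H)) (rep~ x)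
        ; rep-cong = λ x~y → cong (_∙ z) (rep-cong x~y)
        ; rep-⁻¹   = λ x → begin
            rep (x ⁻¹) ∙ z        ≡⟨ cong₂ _∙_ (rep-⁻¹ x) z≡z⁻¹ ⟩
            rep x ⁻¹ ∙ z ⁻¹       ≡⟨ comm _ _ ⟩
            z ⁻¹ ∙ rep x ⁻¹       ≡⟨ ⁻¹-anti-homo-∙ (rep x) z ⟨
            (rep x ∙ z) ⁻¹        ∎
        }
        where
        open ≡-Reasoning
        z≡z⁻¹ : z ≡ z ⁻¹
        z≡z⁻¹ = inverseʳ-unique z z z∙z≡e

  module Cyclic (cyclic : IsCyclic G) where
    open Equivalence

    g : Carrier
    g = proj₁ cyclic

    exponentOf : Carrier → ℕ
    exponentOf x = proj₁ (proj₂ cyclic x)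

    pow-exponentOf : ∀ x → g ^ exponentOf x ≡ x
    pow-exponentOf x = sym (proj₂ (proj₂ cyclic x))

    ∙-comm : ∀ x y → x ∙ y ≡ y ∙ x
    ∙-comm x y = begin
      x ∙ y                     ≡⟨ cong₂ _∙_ (pow-exponentOf x) (pow-exponentOf y) ⟨
      g ^ a ∙ g ^ b             ≡⟨ pow-+ g a b ⟨
      g ^ (a + b)               ≡⟨ cong (g ^_) (+-comm a b) ⟩
      g ^ (b + a)               ≡⟨ pow-+ g b a ⟩
      g ^ b ∙ g ^ a             ≡⟨ cong₂ _∙_ (pow-exponentOf y) (pow-exponentOf x) ⟩
      y ∙ x                     ∎
      where
      open ≡-Reasoning
      a = exponentOf x
      b = exponentOf y

    module LeastExponent {K : Subset G} (K-sub : IsSubgroup G K) {N : ℕ} (g^N∈K : g ^ ℕ.suc N ∈ K) where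
      open Cosets K-sub

      private
        leastK : ∃ λ k → K (g ^ ℕ.suc k) ≡ true × (∀ {j} → j < k → K (g ^ ℕ.suc j) ≡ false)
        leastK = least (λ j → K (g ^ ℕ.suc j)) {N} g^N∈K

      d : ℕ
      d = ℕ.suc (proj₁ leastK)

      g^d∈K : g ^ d ∈ K
      g^d∈K = proj₁ (proj₂ leastK)

      below-d : ∀ {j} → j < d → g ^ j ∈ K → j ≡ 0
      below-d {ℕ.zero}  _   _     = refl
      below-d {ℕ.suc j} j<d g^j∈K with () ← trans (sym g^j∈K) (proj₂ (proj₂ leastK) (s<s⁻¹ j<d))

      ~-mod : ∀ a → g ^ a ~ g ^ (a % d)
      ~-mod a = subst (_~ g ^ (a % d)) split (∈⇒∙~ (pow-∈ K-sub g^d∈K (a / d)))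
        where
        split : g ^ (a / d * d) ∙ g ^ (a % d) ≡ g ^ a
        split = trans (sym (pow-+ g (a / d * d) (a % d)))
                      (cong (g ^_) (trans (+-comm _ (a % d)) (sym (m≡m%n+[m/n]*n a d))))

      private
        ≤-residue-≡ : ∀ {i j} → i ≤ j → j < d → g ^ j ~ g ^ i → i ≡ j
        ≤-residue-≡ {i} {j} i≤j j<d j~i =
          ≤-antisym i≤j (m∸n≡0⇒m≤n (below-d (≤-<-trans (m∸n≤m j i) j<d) (subst (_∈ K) quotient≡ j~i)))
          where
          quotient≡ : g ^ j ∙ (g ^ i) ⁻¹ ≡ g ^ (j ∸ i)
          quotient≡ = trans (cong (λ k → g ^ k ∙ (g ^ i) ⁻¹) (sym (m∸n+n≡m i≤j)))
                            (trans (cong (_∙ (g ^ i) ⁻¹) (pow-+ g (j ∸ i) i)) (//-rightDividesʳ (g ^ i) _))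

      residue-≡ : ∀ {i j} → i < d → j < d → g ^ i ~ g ^ j → i ≡ j
      residue-≡ {i} {j} i<d j<d i~j with ≤-total i j
      ... | inj₁ i≤j = ≤-residue-≡ i≤j j<d (~-sym i~j)
      ... | inj₂ j≤i = sym (≤-residue-≡ j≤i i<d i~j)

      pow~pow⇔ : ∀ a b → g ^ a ~ g ^ b ⇔ a % d ≡ b % d
      pow~pow⇔ a b = mk⇔
        (λ a~b → residue-≡ (m%n<n a d) (m%n<n b d) (~-trans (~-sym (~-mod a)) (~-trans a~b (~-mod b))))
        (λ a≡b → ~-trans (~-mod a) (subst (λ r → g ^ r ~ g ^ b) (sym a≡b) (~-sym (~-mod b))))

      pow∈⇔∣ : ∀ a → g ^ a ∈ K ⇔ d ∣ a
      pow∈⇔∣ a = m%n≡0⇔n∣m a d ⇔-∘ (pow~pow⇔ a 0 ⇔-∘ ⇔-sym ~e⇔∈)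

      residue : Carrier → ℕ
      residue x = exponentOf x % d

      residue<d : ∀ x → residue x < d
      residue<d x = m%n<n (exponentOf x) d

      ~pow-residue : ∀ x → x ~ g ^ residue x
      ~pow-residue x = subst (_~ g ^ residue x) (pow-exponentOf x) (~-mod (exponentOf x))

      ~⇔residue≡ : ∀ {x y} → x ~ y ⇔ residue x ≡ residue y
      ~⇔residue≡ {x} {y} = mk⇔
        (λ x~y → to (pow~pow⇔ (exponentOf x) (exponentOf y))
                    (subst₂ _~_ (sym (pow-exponentOf x)) (sym (pow-exponentOf y)) x~y))
        (λ x≡y → subst₂ _~_ (pow-exponentOf x) (pow-exponentOf y)
                    (from (pow~pow⇔ (exponentOf x) (exponentOf y)) x≡y))

      residue-pow : ∀ a → residue (g ^ a) ≡ a % d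
      residue-pow a =
        to (pow~pow⇔ (exponentOf (g ^ a)) a) (subst (_~ g ^ a) (sym (pow-exponentOf (g ^ a))) ~-refl)

    period : ∃ λ N → g ^ ℕ.suc N ∈ ｛e｝
    period with i , j , i<j , gⁱ≡gʲ ← pigeonhole (n<1+n order) (λ i → Inverse.from enum (g ^ toℕ i)) =
      toℕ j ∸ ℕ.suc (toℕ i) , from ∈｛e｝⇔≡e (identityʳ-unique (g ^ toℕ i) _ gⁱ∙gʲ⁻ⁱ≡gⁱ)
      where
      gⁱ∙gʲ⁻ⁱ≡gⁱ : g ^ toℕ i ∙ g ^ ℕ.suc (toℕ j ∸ ℕ.suc (toℕ i)) ≡ g ^ toℕ i
      gⁱ∙gʲ⁻ⁱ≡gⁱ = trans (sym (pow-+ g (toℕ i) _))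
        (trans (cong (g ^_) (trans (+-suc (toℕ i) _) (m+[n∸m]≡n i<j)))
               (sym (Injection.injective (↔⇒↣ (↔-sym enum)) gⁱ≡gʲ)))

    -- For the trivial subgroup, d is the order of g and residue is the discrete logarithm.
    module Order = LeastExponent ｛e｝-isSubgroup {proj₁ period} (proj₂ period)

    n : ℕ
    n = Order.d

    g^n≡e : g ^ n ≡ e
    g^n≡e = to ∈｛e｝⇔≡e Order.g^d∈K

    pow≡e⇔∣ : ∀ a → g ^ a ≡ e ⇔ n ∣ a
    pow≡e⇔∣ a = Order.pow∈⇔∣ a ⇔-∘ ⇔-sym ∈｛e｝⇔≡e

    log : Carrier → ℕ
    log = Order.residue

    log<n : ∀ x → log x < n
    log<n = Order.residue<d

    pow-log : ∀ x → g ^ log x ≡ x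
    pow-log x = sym (x∙y⁻¹≈ε⇒x≈y x _ (to ∈｛e｝⇔≡e (Order.~pow-residue x)))

    log-pow : ∀ a → log (g ^ a) ≡ a % n
    log-pow = Order.residue-pow

    Fin↔Carrier : Fin n ↔ Carrier
    Fin↔Carrier = mk↔ₛ′ (λ i → g ^ toℕ i) (λ x → fromℕ< (log<n x))
      (λ x → trans (cong (g ^_) (toℕ-fromℕ< (log<n x))) (pow-log x))
      (λ i → toℕ-injective (trans (toℕ-fromℕ< _) (trans (log-pow (toℕ i)) (m<n⇒m%n≡m (toℕ<n i)))))

    n≡order : n ≡ order
    n≡order = ↔⇒≡ (↔-trans Fin↔Carrier (↔-sym enum))

    half-pow≢e : ∀ k → k + k ≡ n → g ^ k ≢ e
    half-pow≢e k k+k≡n g^k≡e = 0≢1+n (trans (cong (λ j → j + j) (sym k≡0)) k+k≡n)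
      where
      k≡0 : k ≡ 0
      k≡0 = Order.below-d (half<whole k+k≡n) (from ∈｛e｝⇔≡e g^k≡e)

    half-pow-involution : ∀ k → k + k ≡ n → g ^ k ∙ g ^ k ≡ e
    half-pow-involution k k+k≡n = trans (sym (pow-+ g k k)) (trans (cong (g ^_) k+k≡n) g^n≡e)

    abelianGroup : AbelianGroup 0ℓ 0ℓ
    abelianGroup = record { isAbelianGroup = record { isGroup = isGroup ; comm = ∙-comm } }

    open AbelianGroupProperties abelianGroup using (⁻¹-∙-comm)
    open CommutativeSemigroupProperties (AbelianGroup.commutativeSemigroup abelianGroup) using (interchange)

    module OfSubgroup {H : Subset G} (H-sub : IsSubgroup G H) where
      open IsSubgroup H-sub
      open Cosets H-sub
      open Transversals H-sub
      open LeastExponent H-sub {proj₁ period} (subst (_∈ H) (sym (to ∈｛e｝⇔≡e (proj₂ period))) has-e)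

      ~-⁻¹ : ∀ {x y} → x ~ y → x ⁻¹ ~ y ⁻¹
      ~-⁻¹ {x} {y} x~y =
        subst (_∈ H) (trans (∙-comm y (x ⁻¹)) (cong (x ⁻¹ ∙_) (sym (⁻¹-involutive y)))) (~-sym x~y)

      ~-∙ : ∀ {x y u v} → x ~ y → u ~ v → x ∙ u ~ y ∙ v
      ~-∙ {x} {y} {u} {v} x~y u~v = subst (_∈ H)
        (trans (interchange x (y ⁻¹) u (v ⁻¹)) (cong (x ∙ u ∙_) (⁻¹-∙-comm y v))) (∙-closed x~y u~v)

      d∣n : d ∣ n
      d∣n = to (pow∈⇔∣ n) (subst (_∈ H) (sym g^n≡e) has-e)

      -- Opaque because unfolding the quotient makes unification blow up.
      opaque
        m : ℕ
        m = quotient d∣n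

        instance
          m-nonZero : NonZero m
          m-nonZero = quotient≢0 d∣n

        n≡m*d : n ≡ m * d
        n≡m*d = m∣n⇒n≡quotient*m d∣n

      Fin↔H : Fin m ↔ ∃ (_∈ H)
      Fin↔H = mk↔ₛ′ (λ i → g ^ (toℕ i * d) , pow-∈ H-sub g^d∈K (toℕ i)) (λ (x , _) → fromℕ< (log/d<m x))
        (λ (x , x∈H) → ∃-≡ (trans (cong (λ k → g ^ (k * d)) (toℕ-fromℕ< (log/d<m x)))
                                  (trans (cong (g ^_) (m/n*n≡m (d∣log x∈H))) (pow-log x))))
        (λ i → toℕ-injective (trans (toℕ-fromℕ< _)
          (trans (cong (_/ d) (trans (log-pow (toℕ i * d)) (m<n⇒m%n≡m (i*d<n i)))) (m*n/n≡m (toℕ i) d))))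
        where
        d∣log : ∀ {x} → x ∈ H → d ∣ log x
        d∣log {x} x∈H = to (pow∈⇔∣ (log x)) (subst (_∈ H) (sym (pow-log x)) x∈H)
        log/d<m : ∀ x → log x / d < m
        log/d<m x = m<n*o⇒m/o<n (subst (log x <_) n≡m*d (log<n x))
        i*d<n : (i : Fin m) → toℕ i * d < n
        i*d<n i = subst (toℕ i * d <_) (sym n≡m*d) (*-monoˡ-< d (toℕ<n i))

      card≡m : card G H ≡ m
      card≡m = ↔⇒≡ (↔-trans (↔-sym (card↔ H)) (↔-sym Fin↔H))

      index≡d : index G H ≡ d
      index≡d = begin
        index G H  ≡⟨ index≡ H card≡m ⟩
        order / m  ≡⟨ cong (_/ m) (trans (sym n≡order) n≡m*d) ⟩
        m * d / m  ≡⟨ cong (_/ m) (*-comm m d) ⟩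
        d * m / m  ≡⟨ m*n/n≡m d m ⟩
        d          ∎
        where open ≡-Reasoning

      involution⇒n∣2log : ∀ {x} → x ∙ x ≡ e → n ∣ log x + log x
      involution⇒n∣2log {x} x∙x≡e =
        to (pow≡e⇔∣ (log x + log x))
           (trans (pow-+ g (log x) (log x)) (trans (cong₂ _∙_ (pow-log x) (pow-log x)) x∙x≡e))

      involution∈H : Even m → ∀ {x} → x ∙ x ≡ e → x ∈ H
      involution∈H (divides m′ m≡m′*2) {x} x∙x≡e = subst (_∈ H) (pow-log x) (from (pow∈⇔∣ (log x)) d∣log)
        where
        2*m′d∣2*log : 2 * (m′ * d) ∣ 2 * log x
        2*m′d∣2*log = subst₂ _∣_
          (trans n≡m*d (trans (cong (_* d) m≡m′*2) (trans (cong (_* d) (*-comm m′ 2)) (*-assoc 2 m′ d))))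
          (cong (log x +_) (sym (+-identityʳ (log x))))
          (involution⇒n∣2log x∙x≡e)
        d∣log : d ∣ log x
        d∣log = m*n∣⇒n∣ m′ d (*-cancelˡ-∣ 2 2*m′d∣2*log)

      involution∈H⇒≡e : Odd m → ∀ {x} → x ∈ H → x ∙ x ≡ e → x ≡ e
      involution∈H⇒≡e m-odd {x} x∈H x∙x≡e = trans (sym (pow-log x)) (from (pow≡e⇔∣ (log x)) n∣log)
        where
        open _∣_ (to (pow∈⇔∣ (log x)) (subst (_∈ H) (sym (pow-log x)) x∈H))
          renaming (quotient to b; equality to log≡b*d)
        m*d∣2*b*d : m * d ∣ 2 * b * d
        m*d∣2*b*d = subst₂ _∣_ n≡m*d
          (trans (cong (λ a → a + a) log≡b*d) (trans (sym (*-distribʳ-+ d b b))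
                 (cong (_* d) (cong (b +_) (sym (+-identityʳ b))))))
          (involution⇒n∣2log x∙x≡e)
        n∣log : n ∣ log x
        n∣log = subst₂ _∣_ (sym n≡m*d) (sym log≡b*d)
          (*-monoˡ-∣ {m} {b} d
            (coprime-divisor (odd⇒coprime-2 m-odd) (*-cancelʳ-∣ {m} {2 * b} d m*d∣2*b*d)))

      pow⁻¹~pow∸ : ∀ {i} → i ≤ d → (g ^ i) ⁻¹ ~ g ^ (d ∸ i)
      pow⁻¹~pow∸ {i} i≤d = subst (_∈ H) g^d⁻¹≡ (⁻¹-closed g^d∈K)
        where
        g^d⁻¹≡ : (g ^ d) ⁻¹ ≡ (g ^ i) ⁻¹ ∙ (g ^ (d ∸ i)) ⁻¹
        g^d⁻¹≡ = trans (cong (λ k → (g ^ k) ⁻¹) (sym (m∸n+n≡m i≤d)))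
                       (trans (cong _⁻¹ (pow-+ g (d ∸ i) i)) (⁻¹-anti-homo-∙ (g ^ (d ∸ i)) (g ^ i)))

      residue-⁻¹ : ∀ x → residue (x ⁻¹) ≡ (d ∸ residue x) % d
      residue-⁻¹ x = trans (to ~⇔residue≡ x⁻¹~g^[d∸r]) (residue-pow (d ∸ residue x))
        where
        x⁻¹~g^[d∸r] : x ⁻¹ ~ g ^ (d ∸ residue x)
        x⁻¹~g^[d∸r] = ~-trans (~-⁻¹ (~pow-residue x)) (pow⁻¹~pow∸ (<⇒≤ (residue<d x)))

      representative : Carrier → ℕ → Carrier
      representative z i with <-cmp i (d ∸ i)
      ... | tri< _ _ _ = g ^ i
      ... | tri≈ _ _ _ = z
      ... | tri> _ _ _ = (g ^ (d ∸ i)) ⁻¹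

      module _ {z : Carrier} where
        representative-< : ∀ {i} → i < d ∸ i → representative z i ≡ g ^ i
        representative-< {i} i<d∸i with <-cmp i (d ∸ i)
        ... | tri< _ _ _    = refl
        ... | tri≈ ¬lt _ _ = contradiction i<d∸i ¬lt
        ... | tri> ¬lt _ _ = contradiction i<d∸i ¬lt

        representative-≡ : ∀ {i} → i ≡ d ∸ i → representative z i ≡ z
        representative-≡ {i} i≡d∸i with <-cmp i (d ∸ i)
        ... | tri< _ ¬eq _ = contradiction i≡d∸i ¬eq
        ... | tri≈ _ _ _    = refl
        ... | tri> _ ¬eq _ = contradiction i≡d∸i ¬eq

        representative-> : ∀ {i} → d ∸ i < i → representative z i ≡ (g ^ (d ∸ i)) ⁻¹
        representative-> {i} d∸i<i with <-cmp i (d ∸ i)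
        ... | tri< _ _ ¬gt = contradiction d∸i<i ¬gt
        ... | tri≈ _ _ ¬gt = contradiction d∸i<i ¬gt
        ... | tri> _ _ _    = refl

        representative~ : (∀ i → i + i ≡ d → z ~ g ^ i) → ∀ {i} → i ≤ d → representative z i ~ g ^ i
        representative~ z~ {i} i≤d with <-cmp i (d ∸ i)
        ... | tri< _ _ _       = ~-refl
        ... | tri≈ _ i≡d∸i _ = z~ i (trans (cong (i +_) i≡d∸i) (m+[n∸m]≡n i≤d))
        ... | tri> _ _ _       =
          subst (λ k → (g ^ (d ∸ i)) ⁻¹ ~ g ^ k) (m∸[m∸n]≡n i≤d) (pow⁻¹~pow∸ (m∸n≤m d i))

        representative-⁻¹ : z ∙ z ≡ e → ∀ {i} → i < d →
                            representative z ((d ∸ i) % d) ≡ representative z i ⁻¹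
        representative-⁻¹ _ {ℕ.zero} _ = begin
          representative z (d % d)  ≡⟨ cong (representative z) (n%n≡0 d) ⟩
          representative z 0        ≡⟨ representative-< z<s ⟩
          e                         ≡⟨ ε⁻¹≈ε ⟨
          e ⁻¹                      ≡⟨ cong _⁻¹ (representative-< z<s) ⟨
          representative z 0 ⁻¹     ∎
          where open ≡-Reasoning
        representative-⁻¹ z∙z≡e {i@(ℕ.suc _)} i<d =
          trans (cong (representative z) (m<n⇒m%n≡m j<d)) (mirror (<-cmp i j))
          where
          j = d ∸ i
          j<d : j < d
          j<d = ∸-monoʳ-< z<s (<⇒≤ i<d)
          d∸j≡i : d ∸ j ≡ i
          d∸j≡i = m∸[m∸n]≡n (<⇒≤ i<d)
          mirror : Tri (i < j) (i ≡ j) (j < i) → representative z j ≡ representative z i ⁻¹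
          mirror (tri< i<j _ _) = trans (representative-> (subst (_< j) (sym d∸j≡i) i<j))
            (trans (cong (λ k → (g ^ k) ⁻¹) d∸j≡i) (sym (cong _⁻¹ (representative-< i<j))))
          mirror (tri≈ _ i≡j _) = trans (representative-≡ (trans (sym i≡j) (sym d∸j≡i)))
            (trans (inverseʳ-unique z z z∙z≡e) (sym (cong _⁻¹ (representative-≡ i≡j))))
          mirror (tri> _ _ j<i) = trans (representative-< (subst (j <_) (sym d∸j≡i) j<i))
            (trans (sym (⁻¹-involutive (g ^ j))) (sym (cong _⁻¹ (representative-> j<i))))

      section : Carrier → Carrier → Carrier
      section z x = representative z (residue x)

      section-symmetric : ∀ {z} → z ∙ z ≡ e → (∀ i → i + i ≡ d → z ~ g ^ i) → IsSymmetricSection (section z)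
      section-symmetric z∙z≡e z~ = record
        { rep~     = λ x → ~-trans (representative~ z~ (<⇒≤ (residue<d x))) (~-sym (~pow-residue x))
        ; rep-cong = λ x~y → cong (representative _) (to ~⇔residue≡ x~y)
        ; rep-⁻¹   = λ x →
            trans (cong (representative _) (residue-⁻¹ x)) (representative-⁻¹ z∙z≡e (residue<d x))
        }

      section-e : ∀ {z} → section z e ≡ e
      section-e {z} = trans (cong (representative z) (residue-pow 0)) (representative-< {z} {0} z<s)

      oddIndexSection : Odd d → IsSymmetricSection (section e)
      oddIndexSection d-odd = section-symmetric (identityˡ e)
        (λ i i+i≡d → contradiction (subst Even i+i≡d (double-even i)) d-odd)

      oddOrderSection : Odd m → ∀ u → u + u ≡ d → IsSymmetricSection (section (g ^ (m * u)))
      oddOrderSection m-odd u u+u≡d = section-symmetric (half-pow-involution (m * u) mu+mu≡n) z~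
        where
        mu+mu≡n : m * u + m * u ≡ n
        mu+mu≡n = trans (sym (*-distribˡ-+ m u u)) (trans (cong (m *_) u+u≡d) (sym n≡m*d))
        mu≡u+[m/2]d : m * u ≡ u + m / 2 * d
        mu≡u+[m/2]d = begin
          m * u                ≡⟨ cong (_* u) (odd⇒≡1+[k/2]*2 m-odd) ⟩
          u + m / 2 * 2 * u    ≡⟨ cong (u +_) (*-assoc (m / 2) 2 u) ⟩
          u + m / 2 * (2 * u)  ≡⟨ cong (λ k → u + m / 2 * k) (trans (cong (u +_) (+-identityʳ u)) u+u≡d) ⟩
          u + m / 2 * d        ∎
          where open ≡-Reasoning
        z~ : ∀ i → i + i ≡ d → g ^ (m * u) ~ g ^ i
        z~ i i+i≡d = subst (λ k → g ^ (m * u) ~ g ^ k) (sym i≡u)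
          (from (pow~pow⇔ (m * u) u) (trans (cong (_% d) mu≡u+[m/2]d) ([m+kn]%n≡m%n u (m / 2) d)))
          where
          i≡u : i ≡ u
          i≡u = *-cancelʳ-≡ i u 2
            (trans (sym (double≡*2 i)) (trans (trans i+i≡d (sym u+u≡d)) (double≡*2 u)))

      odd⊎odd⇒transversal∋e : Odd m ⊎ Odd d → ∃ λ T → e ∈ T × InverseClosed T × IsTransversal T
      odd⊎odd⇒transversal∋e (inj₂ d-odd) = symmetricSection⇒transversal∋e (oddIndexSection d-odd) section-e
      odd⊎odd⇒transversal∋e (inj₁ m-odd) = byParityOfIndex (2 ∣? d)
        where
        byParityOfIndex : Dec (Even d) → ∃ λ T → e ∈ T × InverseClosed T × IsTransversal T
        byParityOfIndex (no d-odd)   = symmetricSection⇒transversal∋e (oddIndexSection d-odd) section-e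
        byParityOfIndex (yes d-even) =
          symmetricSection⇒transversal∋e (uncurry (oddOrderSection m-odd) (even⇒half d-even)) section-e

      even×odd⇒transversal∌e : Even m → Odd d → ∃ λ T → e ∉ T × InverseClosed T × IsTransversal T
      even×odd⇒transversal∌e (divides m′ m≡m′*2) d-odd =
        symmetricSection⇒transversal∌e
          (translate (oddIndexSection d-odd) ∙-comm w∈H (half-pow-involution k k+k≡n)) w≢e
        where
        k = m′ * d
        k+k≡n : k + k ≡ n
        k+k≡n = trans (sym (*-distribʳ-+ d m′ m′))
                      (trans (cong (_* d) (trans (double≡*2 m′) (sym m≡m′*2))) (sym n≡m*d))
        w∈H : g ^ k ∈ H
        w∈H = pow-∈ H-sub g^d∈K m′
        w≢e : section e e ∙ g ^ k ≢ e
        w≢e eq = half-pow≢e k k+k≡n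
          (trans (sym (identityˡ (g ^ k))) (trans (cong (_∙ g ^ k) (sym section-e)) eq))

      even×even⇒¬transversal : Even m → Even d → ∀ {T} → InverseClosed T → IsTransversal T → ⊥
      even×even⇒¬transversal m-even d-even {T} T-ic tr
        with u , u+u≡d ← even⇒half d-even
        with t , t∈T , t~gᵘ ← IsTransversal.cover tr (g ^ u) =
        0≢1+n (trans (cong (λ k → k + k) (sym u≡0)) u+u≡d)
        where
        gᵘ∙gᵘ∈H : g ^ u ∙ g ^ u ∈ H
        gᵘ∙gᵘ∈H = subst (_∈ H) (trans (cong (g ^_) (sym u+u≡d)) (pow-+ g u u)) g^d∈K
        t∙t∈H : t ∙ t ∈ H
        t∙t∈H = to ~e⇔∈ (~-trans (~-∙ t~gᵘ t~gᵘ) (from ~e⇔∈ gᵘ∙gᵘ∈H))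
        t∈H : t ∈ H
        t∈H = involution∈H m-even (square∈⇒square≡e T-ic tr t∈T t∙t∈H)
        u≡0 : u ≡ 0
        u≡0 = below-d (half<whole u+u≡d) (to ~e⇔∈ (~-trans (~-sym t~gᵘ) (from ~e⇔∈ t∈H)))

      odd-order⇒e∈transversal : Odd m → ∀ {T} → InverseClosed T → IsTransversal T → e ∈ T
      odd-order⇒e∈transversal m-odd {T} T-ic tr with s , s∈T , s~e ← IsTransversal.cover tr e =
        subst (_∈ T) s≡e s∈T
        where
        s∈H : s ∈ H
        s∈H = to ~e⇔∈ s~e
        s≡e : s ≡ e
        s≡e = involution∈H⇒≡e m-odd s∈H (square∈⇒square≡e T-ic tr s∈T (∙-closed s∈H s∈H))

      perfectCode⇔odd⊎odd : IsPerfectCodeOfGroup G H ⇔ (Odd m ⊎ Odd d)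
      perfectCode⇔odd⊎odd = mk⇔ (λ pc → odd⊎odd (proj₂ (to perfectCode⇔ pc)) (2 ∣? m) (2 ∣? d))
                                 (from perfectCode⇔ ∘ odd⊎odd⇒transversal∋e)
        where
        odd⊎odd : ∀ {T} → e ∈ T × InverseClosed T × IsTransversal T →
                  Dec (Even m) → Dec (Even d) → Odd m ⊎ Odd d
        odd⊎odd _               (no m-odd)   _            = inj₁ m-odd
        odd⊎odd _               (yes _)      (no d-odd)   = inj₂ d-odd
        odd⊎odd (_ , T-ic , tr) (yes m-even) (yes d-even) =
          ⊥-elim (even×even⇒¬transversal m-even d-even T-ic tr)

      totalPerfectCode⇔even×odd : IsTotalPerfectCodeOfGroup G H ⇔ (Even m × Odd d)
      totalPerfectCode⇔even×odd = mk⇔ (λ tpc → even×odd (proj₂ (to totalPerfectCode⇔ tpc)))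
                                       (from totalPerfectCode⇔ ∘ uncurry even×odd⇒transversal∌e)
        where
        even×odd : ∀ {T} → e ∉ T × InverseClosed T × IsTransversal T → Even m × Odd d
        even×odd {T} (e∉T , T-ic , tr) = m-even , λ d-even → even×even⇒¬transversal m-even d-even T-ic tr
          where
          m-even : Even m
          m-even = decidable-stable (2 ∣? m)
            (λ m-odd → contradiction (trans (sym e∉T) (odd-order⇒e∈transversal m-odd T-ic tr)) λ ())

corollary2p8 : (G : FiniteGroup) → IsCyclic G → (H : Subset G) → IsSubgroup G H →
    (IsPerfectCodeOfGroup G H ⇔ (Odd (card G H) ⊎ Odd (index G H)))
    × (IsTotalPerfectCodeOfGroup G H ⇔ (Even (card G H) × Odd (index G H)))
corollary2p8 G cyclic H H-sub =
  subst₂ (λ c i → (IsPerfectCodeOfGroup G H ⇔ (Odd c ⊎ Odd i))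
                 × (IsTotalPerfectCodeOfGroup G H ⇔ (Even c × Odd i)))
         (sym card≡m) (sym index≡d)
         (perfectCode⇔odd⊎odd , totalPerfectCode⇔even×odd)
  where
  open Cyclic G cyclic
  open OfSubgroup H-sub
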